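{- Let $\Gamma$ be an impartial game and let $A$ be a full position of $\Gamma$. If $\lg_\Gamma(A)>0$, then $A$ has a full option $B$ with $\lg_\Gamma(B)=\lg_\Gamma(A)-1$. In particular, for every $\beta$ with $0\le\beta\le\lg_\Gamma(A)-1$, $A$ has a full descendant $B$ with $\lg_\Gamma(B)=\beta$.
   Context: An impartial game is a digraph whose vertices are positions and edges moves, such that the maximum length $\lg_\Gamma(A)$ of a walk starting at each vertex $A$ is finite. $B$ is an option of $A$ if $(A,B)$ is an edge, a descendant if there is a path from $A$ to $B$. $\mathrm{sg}_\Gamma(A)=\operatorname{mex}\{\mathrm{sg}_\Gamma(B):B\text{ an option of }A\}$ with $\operatorname{mex}S=\min(\mathbb N\setminus S)$. Always $\mathrm{sg}_\Gamma(A)\le\lg_\Gamma(A)$; a position $A$ is full if $\mathrm{sg}_\Gamma(A)=\lg_\Gamma(A)$. -}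

module Defs where

open import Data.Nat using (ℕ; zero; suc; _≤_; _<_)
open import Data.Product using (Σ; ∃; _×_; _,_; proj₁)
open import Relation.Nullary using (¬_)
open import Relation.Binary.PropositionalEquality using (_≡_)

data Walk {Pos : Set} (_⇒_ : Pos → Pos → Set) : Pos → ℕ → Set where
  []  : ∀ {A} → Walk _⇒_ A zero
  _∷_ : ∀ {A B n} → A ⇒ B → Walk _⇒_ B n → Walk _⇒_ A (suc n)

IsMaxWalkLength : {Pos : Set} (_⇒_ : Pos → Pos → Set) → Pos → ℕ → Set
IsMaxWalkLength _⇒_ A n = Walk _⇒_ A n × (∀ m → Walk _⇒_ A m → m ≤ n)

record Game : Set₁ where
  field
    Pos    : Set
    _⇒_    : Pos → Pos → Set
    finite : ∀ A → ∃ λ n → IsMaxWalkLength _⇒_ A n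

open Game public

lg : (Γ : Game) → Pos Γ → ℕ
lg Γ A = proj₁ (finite Γ A)

Option : (Γ : Game) → Pos Γ → Pos Γ → Set
Option Γ A B = _⇒_ Γ A B

data Reach (Γ : Game) : Pos Γ → Pos Γ → Set where
  here  : ∀ {A} → Reach Γ A A
  there : ∀ {A B C} → Option Γ A B → Reach Γ B C → Reach Γ A C

Descendant : (Γ : Game) → Pos Γ → Pos Γ → Set
Descendant Γ A B = ∃ λ C → Option Γ A C × Reach Γ C B

IsMex : (ℕ → Set) → ℕ → Set
IsMex S m = ¬ S m × (∀ k → k < m → S k)

IsSG : (Γ : Game) → (Pos Γ → ℕ) → Set
IsSG Γ sg = ∀ A → IsMex (λ k → ∃ λ B → Option Γ A B × sg B ≡ k) (sg A)

Full : (Γ : Game) → (Pos Γ → ℕ) → Pos Γ → Set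
Full Γ sg A = sg A ≡ lg Γ A

-- A move strictly lowers lg, and sg ≤ lg follows by induction on lg. If A is full with
-- lg A = n + 1, then n < sg A, so by the mex property some option B has sg B = n;
-- since n = sg B ≤ lg B < lg A = n + 1, B is full with lg B = n. Iterating gives full
-- descendants of every smaller length.
module Submission where

open import Defs
open import Data.Nat using (ℕ; suc; _≤_; _<_; _∸_; s≤s)
open import Data.Nat.Properties
  using (≤-antisym; ≤-pred; ≤-<-trans; <-irrefl; ≰⇒>; _≤?_; m≤n⇒m<n∨m≡n; suc-pred; n<1+n)
open import Data.Nat.Base using (>-nonZero)
open import Data.Nat.Induction using (<-wellFounded)
open import Data.Product using (∃; _×_; _,_; proj₁; proj₂)
open import Data.Sum using (inj₁; inj₂)
open import Induction.WellFounded using (Acc; acc)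
open import Relation.Nullary using (yes; no; contradiction)
open import Relation.Binary.PropositionalEquality using (_≡_; refl; sym; trans; subst)

lg-option-< : (Γ : Game) {A B : Pos Γ} → Option Γ A B → lg Γ B < lg Γ A
lg-option-< Γ {A} {B} A⇒B =
  proj₂ (proj₂ (finite Γ A)) (suc (lg Γ B)) (A⇒B ∷ proj₁ (proj₂ (finite Γ B)))

module _ (Γ : Game) (sg : Pos Γ → ℕ) (isSG : IsSG Γ sg) where

  sg≤lg : ∀ A → sg A ≤ lg Γ A
  sg≤lg A = go A (<-wellFounded (lg Γ A))
    where
      go : ∀ A → Acc _<_ (lg Γ A) → sg A ≤ lg Γ A
      go A (acc rec) with sg A ≤? lg Γ A
      ... | yes sgA≤lgA = sgA≤lgA
      ... | no sgA≰lgA with proj₂ (isSG A) (lg Γ A) (≰⇒> sgA≰lgA)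
      ... | C , A⇒C , sgC≡lgA =
        contradiction (≤-<-trans (go C (rec lgC<lgA)) lgC<lgA) (<-irrefl sgC≡lgA)
        where
          lgC<lgA : lg Γ C < lg Γ A
          lgC<lgA = lg-option-< Γ A⇒C

  full-option : ∀ {A n} → Full Γ sg A → lg Γ A ≡ suc n →
                ∃ λ B → Option Γ A B × Full Γ sg B × lg Γ B ≡ n
  full-option {A} {n} fullA lgA≡1+n with proj₂ (isSG A) n n<sgA
    where
      n<sgA : n < sg A
      n<sgA = subst (n <_) (sym (trans fullA lgA≡1+n)) (n<1+n n)
  ... | B , A⇒B , sgB≡n = B , A⇒B , trans sgB≡n (sym lgB≡n) , lgB≡n
    where
      lgB≡n : lg Γ B ≡ n
      lgB≡n = ≤-antisym (≤-pred (subst (lg Γ B <_) lgA≡1+n (lg-option-< Γ A⇒B)))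
                        (subst (_≤ lg Γ B) sgB≡n (sg≤lg B))

  full-reach : ∀ n {A β} → Full Γ sg A → lg Γ A ≡ n → β ≤ n →
               ∃ λ B → Reach Γ A B × Full Γ sg B × lg Γ B ≡ β
  full-reach n {A} fullA lgA≡n β≤n with m≤n⇒m<n∨m≡n β≤n
  ... | inj₂ refl = A , here , fullA , lgA≡n
  full-reach (suc n) fullA lgA≡1+n β≤1+n | inj₁ (s≤s β≤n)
    with full-option fullA lgA≡1+n
  ... | B , A⇒B , fullB , lgB≡n with full-reach n fullB lgB≡n β≤n
  ... | C , B↠C , fullC , lgC≡β = C , there A⇒B B↠C , fullC , lgC≡β

lemma3p18 : (Γ : Game) (sg : Pos Γ → ℕ) → IsSG Γ sg →
            (A : Pos Γ) → Full Γ sg A → 0 < lg Γ A →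
            (∃ λ B → Option Γ A B × Full Γ sg B × lg Γ B ≡ lg Γ A ∸ 1)
            × (∀ β → β ≤ lg Γ A ∸ 1 →
                 ∃ λ B → Descendant Γ A B × Full Γ sg B × lg Γ B ≡ β)
lemma3p18 Γ sg isSG A fullA 0<lgA = fullOption , fullDescendant
  where
    lgA≡1+pred : lg Γ A ≡ suc (lg Γ A ∸ 1)
    lgA≡1+pred = sym (suc-pred (lg Γ A) {{>-nonZero 0<lgA}})

    fullOption : ∃ λ B → Option Γ A B × Full Γ sg B × lg Γ B ≡ lg Γ A ∸ 1
    fullOption = full-option Γ sg isSG fullA lgA≡1+pred

    fullDescendant : ∀ β → β ≤ lg Γ A ∸ 1 →
                     ∃ λ C → Descendant Γ A C × Full Γ sg C × lg Γ C ≡ β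
    fullDescendant β β≤lgB with fullOption
    ... | B , A⇒B , fullB , lgB≡pred with full-reach Γ sg isSG _ fullB lgB≡pred β≤lgB
    ... | C , B↠C , fullC , lgC≡β = C , (B , A⇒B , B↠C) , fullC , lgC≡β
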